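{- For every integer $\ell\ge1$ and every $n\in\mathbb{Z}$, $$f(\ell n,x,s)-\frac{f(2\ell,x,s)}{f(\ell,x,q^{\ell}s)}f(\ell(n-1),x,q^{\ell}s)+(-1)^{\ell}q^{\frac{\ell(3\ell-1)}{2}}s^{\ell}\frac{f(\ell,x,s)}{f(\ell,x,q^{\ell}s)}f(\ell(n-2),x,q^{2\ell}s)=0 .$$
   Context: The (Carlitz) $q$-Fibonacci polynomials $f(n,x,s)$ are defined by $f(n,x,s)=xf(n-1,x,s)+q^{n-2}sf(n-2,x,s)$ with $f(0,x,s)=0$, $f(1,x,s)=1$. The same recurrence, run backwards, extends the definition to all integers $n$ (the values are then rational functions in $x,s,q$); the recurrence holds for all $n\in\mathbb{Z}$. -}

module Defs where

open import Algebra.Bundles using (CommutativeRing)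
open import Data.Nat using (ℕ; zero; suc)
open import Data.Integer using (ℤ; +_; -[1+_])
open import Data.Product using (_×_; _,_; proj₁)

-- Parameters: q, x, s, and si (intended: an inverse of s, needed to run the
-- recurrence f(n) = x f(n-1) + q^(n-2) s f(n-2) backwards to negative n).
module QFib {c ℓ} (R : CommutativeRing c ℓ) where
  open CommutativeRing R

  pow : Carrier → ℕ → Carrier
  pow a zero    = 1#
  pow a (suc n) = a * pow a n

  -- fPair q x s n = (f(n), f(n+1)) for n ≥ 0
  fPair : Carrier → Carrier → Carrier → ℕ → Carrier × Carrier
  fPair q x s zero = (0# , 1#)
  fPair q x s (suc n) with fPair q x s n
  ... | (a , b) = (b , x * b + pow q n * s * a)

  -- fNeg q x s si m = (f(-m), f(1-m)) for m ≥ 0, using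
  -- f(k-2) = (f(k) - x f(k-1)) / (q^(k-2) s)  with k - 2 = -(m+1),
  -- i.e. division by q^(-(m+1)) s is multiplication by q^(m+1) * si.
  fNeg : Carrier → Carrier → Carrier → Carrier → ℕ → Carrier × Carrier
  fNeg q x s si zero = (0# , 1#)
  fNeg q x s si (suc m) with fNeg q x s si m
  ... | (a , b) = ((b - x * a) * pow q (suc m) * si , a)

  f : Carrier → Carrier → Carrier → Carrier → ℤ → Carrier
  f q x s si (+ n)      = proj₁ (fPair q x s n)
  f q x s si -[1+ m ]   = proj₁ (fNeg q x s si (suc m))

-- Both m ↦ f(m, x, s) and, for every k, m ↦ f(m − k, x, q^k s) solve the same two-sided
-- recurrence a(m+2) = x a(m+1) + q^m s a(m) on ℤ. With q and s invertible, such a solution is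
-- determined by two consecutive values, so the three-term combination vanishes identically as
-- soon as it vanishes at m = 2ℓ and m = 2ℓ+1. The first is immediate; the second is the identity
--   f(2ℓ+1) f(ℓ, q^ℓ s) + (−1)^ℓ q^(ℓ(3ℓ−1)/2) s^ℓ f(ℓ) = f(2ℓ) f(ℓ+1, q^ℓ s),
-- which follows from the addition formula for f and a Cassini-type identity for the pair
-- f(·, q σ), f(·, σ). The theorem is the case m = ℓ n.
module Submission where

open import Defs
open import Algebra.Bundles using (CommutativeRing)
open import Data.Nat using (ℕ; _≤_; _∸_)
open import Data.Nat.DivMod using (_/_)
import Data.Nat as N
import Data.Integer as Z

open import Data.Nat using (zero; suc)
open import Data.Nat.DivMod using (m*n/n≡m)
open import Data.Integer using (ℤ; +_; -[1+_])
import Data.Nat.Properties as NP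
import Data.Integer.Properties as ZP
import Data.Nat.Tactic.RingSolver as NatSolver
import Data.Integer.Tactic.RingSolver as IntSolver
open import Data.List using (_∷_; [])
open import Data.Maybe using (nothing)
open import Data.Product using (_×_; _,_; proj₁)
open import Relation.Binary.PropositionalEquality as P using (_≡_)

triangular : ℕ → ℕ
triangular zero    = 0
triangular (suc j) = triangular j N.+ suc j

module _ where
  open P.≡-Reasoning

  2*triangular : ∀ j → 2 N.* triangular j ≡ j N.* suc j
  2*triangular zero    = P.refl
  2*triangular (suc j) = begin
    2 N.* (triangular j N.+ suc j)      ≡⟨ NP.*-distribˡ-+ 2 (triangular j) (suc j) ⟩
    2 N.* triangular j N.+ 2 N.* suc j  ≡⟨ P.cong (N._+ 2 N.* suc j) (2*triangular j) ⟩
    j N.* suc j N.+ 2 N.* suc j         ≡⟨ NatSolver.solve (j ∷ []) ⟩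
    suc j N.* suc (suc j)               ∎

  pentagonal-number : ∀ j (let l = suc j) → (l N.* (3 N.* l ∸ 1)) / 2 ≡ triangular j N.+ l N.* l
  pentagonal-number j = P.trans (P.cong (_/ 2) twice) (m*n/n≡m (triangular j N.+ suc j N.* suc j) 2)
    where
    twice : suc j N.* (3 N.* suc j ∸ 1) ≡ (triangular j N.+ suc j N.* suc j) N.* 2
    twice = begin
      suc j N.* (j N.+ 2 N.* suc j)                     ≡⟨ NatSolver.solve (j ∷ []) ⟩
      j N.* suc j N.+ 2 N.* (suc j N.* suc j)
        ≡⟨ P.cong (N._+ 2 N.* (suc j N.* suc j)) (P.sym (2*triangular j)) ⟩
      2 N.* triangular j N.+ 2 N.* (suc j N.* suc j)
        ≡⟨ P.sym (NP.*-distribˡ-+ 2 (triangular j) (suc j N.* suc j)) ⟩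
      2 N.* (triangular j N.+ suc j N.* suc j)          ≡⟨ NP.*-comm 2 (triangular j N.+ suc j N.* suc j) ⟩
      (triangular j N.+ suc j N.* suc j) N.* 2          ∎

ℤ-propagate : ∀ {p} (P : ℤ → Set p) → (∀ m → P m → P (Z.suc m)) → (∀ m → P (Z.suc m) → P m) →
              ∀ m₀ → P m₀ → ∀ m → P m
ℤ-propagate P up down m₀ pm₀ m = from0 m (to0 m₀ pm₀)
  where
  to0 : ∀ m → P m → P (+ 0)
  to0 (+ zero)         pm = pm
  to0 (+ suc n)        pm = to0 (+ n) (down (+ n) pm)
  to0 -[1+ zero ]      pm = up -[1+ 0 ] pm
  to0 -[1+ suc n ]     pm = to0 -[1+ n ] (up -[1+ suc n ] pm)
  from0 : ∀ m → P (+ 0) → P m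
  from0 (+ zero)       p0 = p0
  from0 (+ suc n)      p0 = up (+ n) (from0 (+ n) p0)
  from0 -[1+ zero ]    p0 = down -[1+ 0 ] p0
  from0 -[1+ suc n ]   p0 = down -[1+ suc n ] (from0 -[1+ n ] p0)

suc[i]-j≡suc[i-j] : ∀ i j → Z.suc i Z.- j ≡ Z.suc (i Z.- j)
suc[i]-j≡suc[i-j] i j = ZP.+-assoc (+ 1) i (Z.- j)

i+[j-i]≡j : ∀ i j → i Z.+ (j Z.- i) ≡ j
i+[j-i]≡j = IntSolver.solve-∀

+[2*l]-+l≡+l : ∀ l → + (2 N.* l) Z.- + l ≡ + l
+[2*l]-+l≡+l l = P.trans (P.cong (Z._- + l) (ZP.pos-* 2 l)) (2i-i≡i (+ l))
  where
  2i-i≡i : ∀ i → + 2 Z.* i Z.- i ≡ i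
  2i-i≡i = IntSolver.solve-∀

i*[j-1]≡i*j-i : ∀ i j → i Z.* (j Z.- + 1) ≡ i Z.* j Z.- i
i*[j-1]≡i*j-i = IntSolver.solve-∀

+l*[n-2]≡+l*n-+[2*l] : ∀ l n → + l Z.* (n Z.- + 2) ≡ + l Z.* n Z.- + (2 N.* l)
+l*[n-2]≡+l*n-+[2*l] l n =
  P.trans (i*[j-2]≡i*j-2i (+ l) n) (P.cong (λ t → + l Z.* n Z.- t) (P.sym (ZP.pos-* 2 l)))
  where
  i*[j-2]≡i*j-2i : ∀ i j → i Z.* (j Z.- + 2) ≡ i Z.* j Z.- + 2 Z.* i
  i*[j-2]≡i*j-2i = IntSolver.solve-∀

module QFibProperties {c r} (R : CommutativeRing c r) where
  open CommutativeRing R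
  open QFib R
  open import Relation.Binary.Reasoning.Setoid setoid
  open import Algebra.Properties.Ring ring using (-‿distribʳ-*; -1*x≈-x; -‿+-comm; x≈y⇒x∙y⁻¹≈ε)
  open import Algebra.Properties.Semiring.Exp semiring using (_^_; ^-homo-*; ^-assocʳ)
  open import Algebra.Properties.CommutativeSemiring.Exp commutativeSemiring using (^-distrib-*)
  open import Algebra.Solver.Ring.NaturalCoefficients commutativeSemiring (λ _ _ → nothing)
    using (solve; _:+_; _:*_; _:=_)

  pow≡^ : ∀ a n → pow a n ≡ a ^ n
  pow≡^ a zero    = P.refl
  pow≡^ a (suc n) = P.cong (a *_) (pow≡^ a n)

  pow-+ : ∀ a m n → pow a (m N.+ n) ≈ pow a m * pow a n
  pow-+ a m n rewrite pow≡^ a (m N.+ n) | pow≡^ a m | pow≡^ a n = ^-homo-* a m n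

  pow-pow : ∀ a m n → pow (pow a m) n ≈ pow a (m N.* n)
  pow-pow a m n rewrite pow≡^ (pow a m) n | pow≡^ a m | pow≡^ a (m N.* n) = ^-assocʳ a m n

  pow-distrib-* : ∀ a b n → pow (a * b) n ≈ pow a n * pow b n
  pow-distrib-* a b n rewrite pow≡^ (a * b) n | pow≡^ a n | pow≡^ b n = ^-distrib-* a b n

  inverse-* : ∀ {a a′ b b′} → a * a′ ≈ 1# → b * b′ ≈ 1# → (a * b) * (a′ * b′) ≈ 1#
  inverse-* {a} {a′} {b} {b′} aa′≈1 bb′≈1 = begin
    (a * b) * (a′ * b′)
      ≈⟨ solve 4 (λ a b a′ b′ → (a :* b) :* (a′ :* b′) := (a :* a′) :* (b :* b′)) refl a b a′ b′ ⟩
    (a * a′) * (b * b′) ≈⟨ *-cong aa′≈1 bb′≈1 ⟩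
    1# * 1#             ≈⟨ *-identityˡ 1# ⟩
    1#                  ∎

  pow-inverse : ∀ {a a′} → a * a′ ≈ 1# → ∀ n → pow a n * pow a′ n ≈ 1#
  pow-inverse aa′≈1 zero    = *-identityˡ 1#
  pow-inverse aa′≈1 (suc n) = inverse-* aa′≈1 (pow-inverse aa′≈1 n)

  invertible⇒cancelˡ : ∀ {u u′ y} → u′ * u ≈ 1# → u * y ≈ 0# → y ≈ 0#
  invertible⇒cancelˡ {u} {u′} {y} u′u≈1 uy≈0 = begin
    y             ≈⟨ *-identityˡ y ⟨
    1# * y        ≈⟨ *-congʳ u′u≈1 ⟨
    (u′ * u) * y  ≈⟨ *-assoc u′ u y ⟩
    u′ * (u * y)  ≈⟨ *-congˡ uy≈0 ⟩
    u′ * 0#       ≈⟨ zeroʳ u′ ⟩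
    0#            ∎

  a+c≈b⇒a-b+c≈0 : ∀ {a b c} → a + c ≈ b → a - b + c ≈ 0#
  a+c≈b⇒a-b+c≈0 {a} {b} {c} a+c≈b = begin
    a + - b + c  ≈⟨ solve 3 (λ a b c → a :+ b :+ c := a :+ c :+ b) refl a (- b) c ⟩
    a + c - b    ≈⟨ x≈y⇒x∙y⁻¹≈ε a+c≈b ⟩
    0#           ∎

  module _ (x : Carrier) where
    Recurrence : (ℤ → Carrier) → (ℤ → Carrier) → Set r
    Recurrence w a = ∀ m → a (Z.suc (Z.suc m)) ≈ x * a (Z.suc m) + w m * a m

    Recurrence-+ : ∀ {w a b} → Recurrence w a → Recurrence w b → Recurrence w (λ m → a m + b m)
    Recurrence-+ {w} {a} {b} ra rb m = begin
      a (Z.suc m₁) + b (Z.suc m₁)                        ≈⟨ +-cong (ra m) (rb m) ⟩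
      (x * a m₁ + w m * a m) + (x * b m₁ + w m * b m)
        ≈⟨ solve 6 (λ x w a₁ a₀ b₁ b₀ → (x :* a₁ :+ w :* a₀) :+ (x :* b₁ :+ w :* b₀)
                                       := x :* (a₁ :+ b₁) :+ w :* (a₀ :+ b₀))
                   refl x (w m) (a m₁) (a m) (b m₁) (b m) ⟩
      x * (a m₁ + b m₁) + w m * (a m + b m)               ∎
      where m₁ = Z.suc m

    Recurrence-*ˡ : ∀ {w a} α → Recurrence w a → Recurrence w (λ m → α * a m)
    Recurrence-*ˡ {w} {a} α ra m = begin
      α * a (Z.suc m₁)                ≈⟨ *-congˡ (ra m) ⟩
      α * (x * a m₁ + w m * a m)
        ≈⟨ solve 5 (λ α x w a₁ a₀ → α :* (x :* a₁ :+ w :* a₀) := x :* (α :* a₁) :+ w :* (α :* a₀))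
                   refl α x (w m) (a m₁) (a m) ⟩
      x * (α * a m₁) + w m * (α * a m) ∎
      where m₁ = Z.suc m

    Recurrence-neg : ∀ {w a} → Recurrence w a → Recurrence w (λ m → - a m)
    Recurrence-neg {w} {a} ra m = begin
      - a (Z.suc m₁)                  ≈⟨ -‿cong (ra m) ⟩
      - (x * a m₁ + w m * a m)        ≈⟨ -‿+-comm (x * a m₁) (w m * a m) ⟨
      - (x * a m₁) + - (w m * a m)    ≈⟨ +-cong (-‿distribʳ-* x (a m₁)) (-‿distribʳ-* (w m) (a m)) ⟩
      x * - a m₁ + w m * - a m        ∎
      where m₁ = Z.suc m

    Recurrence-shift : ∀ {w a} k → Recurrence w a → Recurrence (λ m → w (m Z.- k)) (λ m → a (m Z.- k))
    Recurrence-shift {w} {a} k ra m = begin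
      a (Z.suc (Z.suc m) Z.- k)
        ≈⟨ reflexive (P.cong a (P.trans (suc[i]-j≡suc[i-j] (Z.suc m) k) (P.cong Z.suc (suc[i]-j≡suc[i-j] m k)))) ⟩
      a (Z.suc (Z.suc (m Z.- k)))                              ≈⟨ ra (m Z.- k) ⟩
      x * a (Z.suc (m Z.- k)) + w (m Z.- k) * a (m Z.- k)
        ≈⟨ +-congʳ (*-congˡ (reflexive (P.cong a (P.sym (suc[i]-j≡suc[i-j] m k))))) ⟩
      x * a (Z.suc m Z.- k) + w (m Z.- k) * a (m Z.- k)        ∎

    Recurrence-reweight : ∀ {w w′ a} → (∀ m → w m ≈ w′ m) → Recurrence w a → Recurrence w′ a
    Recurrence-reweight w≈w′ ra m = trans (ra m) (+-congˡ (*-congʳ (w≈w′ m)))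

    Recurrence-vanishing : ∀ {w a} → Recurrence w a → (∀ m {y} → w m * y ≈ 0# → y ≈ 0#) →
                           ∀ m₀ → a m₀ ≈ 0# → a (Z.suc m₀) ≈ 0# → ∀ m → a m ≈ 0#
    Recurrence-vanishing {w} {a} ra cancel m₀ a₀≈0 a₁≈0 m =
      proj₁ (ℤ-propagate VanishesAt forward backward m₀ (a₀≈0 , a₁≈0) m)
      where
      VanishesAt : ℤ → Set r
      VanishesAt m = a m ≈ 0# × a (Z.suc m) ≈ 0#

      forward : ∀ m → VanishesAt m → VanishesAt (Z.suc m)
      forward m (a₀≈0 , a₁≈0) = a₁≈0 , (begin
        a (Z.suc (Z.suc m))          ≈⟨ ra m ⟩
        x * a (Z.suc m) + w m * a m  ≈⟨ +-cong (*-congˡ a₁≈0) (*-congˡ a₀≈0) ⟩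
        x * 0# + w m * 0#            ≈⟨ +-cong (zeroʳ x) (zeroʳ (w m)) ⟩
        0# + 0#                      ≈⟨ +-identityʳ 0# ⟩
        0#                           ∎)

      backward : ∀ m → VanishesAt (Z.suc m) → VanishesAt m
      backward m (a₁≈0 , a₂≈0) = cancel m (begin
        w m * a m                    ≈⟨ +-identityˡ (w m * a m) ⟨
        0# + w m * a m               ≈⟨ +-congʳ (trans (*-congˡ a₁≈0) (zeroʳ x)) ⟨
        x * a (Z.suc m) + w m * a m  ≈⟨ ra m ⟨
        a (Z.suc (Z.suc m))          ≈⟨ a₂≈0 ⟩
        0#                           ∎) , a₁≈0

  module _ (q x : Carrier) where
    F : Carrier → ℕ → Carrier
    F s n = proj₁ (fPair q x s n)

    F-2 : ∀ s → F s 2 ≈ x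
    F-2 s = trans (+-cong (*-identityʳ x) (zeroʳ (1# * s))) (+-identityʳ x)

    F-add : ∀ s k j (let σ = pow q k * s) →
            F s (suc (j N.+ k)) ≈ F s (suc k) * F σ (suc j) + σ * F s k * F (q * σ) j
    F-add s k zero = begin
      F s (suc k)                              ≈⟨ *-identityʳ (F s (suc k)) ⟨
      F s (suc k) * 1#                         ≈⟨ +-identityʳ (F s (suc k) * 1#) ⟨
      F s (suc k) * 1# + 0#                    ≈⟨ +-congˡ (zeroʳ (pow q k * s * F s k)) ⟨
      F s (suc k) * 1# + pow q k * s * F s k * 0# ∎
    F-add s k (suc zero) = begin
      x * F s (suc k) + pow q k * s * F s k
        ≈⟨ +-cong (*-comm (F s (suc k)) x) (*-identityʳ (pow q k * s * F s k)) ⟨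
      F s (suc k) * x + pow q k * s * F s k * 1#
        ≈⟨ +-congʳ (*-congˡ (F-2 (pow q k * s))) ⟨
      F s (suc k) * F (pow q k * s) 2 + pow q k * s * F s k * 1# ∎
    F-add s k (suc (suc j)) = begin
      x * F s (suc (suc (j N.+ k))) + q * pow q (j N.+ k) * s * F s (suc (j N.+ k))
        ≈⟨ +-cong (*-congˡ (F-add s k (suc j))) (*-cong (*-congʳ (*-congˡ (pow-+ q j k))) (F-add s k j)) ⟩
      x * (a₁ * b₂ + σ * a₀ * c₁) + q * (pⱼ * pₖ) * s * (a₁ * b₁ + σ * a₀ * c₀)
        ≈⟨ solve 11 (λ x q s pⱼ pₖ a₁ a₀ b₂ b₁ c₁ c₀ →
             x :* (a₁ :* b₂ :+ pₖ :* s :* a₀ :* c₁)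
               :+ q :* (pⱼ :* pₖ) :* s :* (a₁ :* b₁ :+ pₖ :* s :* a₀ :* c₀)
             := a₁ :* (x :* b₂ :+ q :* pⱼ :* (pₖ :* s) :* b₁)
               :+ pₖ :* s :* a₀ :* (x :* c₁ :+ pⱼ :* (q :* (pₖ :* s)) :* c₀))
             refl x q s pⱼ pₖ a₁ a₀ b₂ b₁ c₁ c₀ ⟩
      a₁ * F σ (suc (suc (suc j))) + σ * a₀ * F (q * σ) (suc (suc j)) ∎
      where
      σ = pow q k * s
      pⱼ = pow q j
      pₖ = pow q k
      a₁ = F s (suc k)
      a₀ = F s k
      b₂ = F σ (suc (suc j))
      b₁ = F σ (suc j)
      c₁ = F (q * σ) (suc j)
      c₀ = F (q * σ) j

    cassiniTerm : Carrier → ℕ → Carrier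
    cassiniTerm σ j = pow (- 1#) j * pow q (triangular j) * pow σ j

    cassiniTerm-suc : ∀ σ j → cassiniTerm σ (suc j) + q * pow q j * σ * cassiniTerm σ j ≈ 0#
    cassiniTerm-suc σ j = begin
      - 1# * M * pow q (triangular j N.+ suc j) * (σ * S) + Q * (M * T * S)
        ≈⟨ +-congʳ (*-congʳ (*-congˡ (pow-+ q (triangular j) (suc j)))) ⟩
      - 1# * M * (T * (q * pow q j)) * (σ * S) + Q * (M * T * S)
        ≈⟨ +-congʳ (solve 7 (λ n M T q p σ S → n :* M :* (T :* (q :* p)) :* (σ :* S)
                                               := n :* (q :* p :* σ :* (M :* T :* S)))
                            refl (- 1#) M T q (pow q j) σ S) ⟩
      - 1# * (Q * (M * T * S)) + Q * (M * T * S)   ≈⟨ +-congʳ (-1*x≈-x (Q * (M * T * S))) ⟩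
      - (Q * (M * T * S)) + Q * (M * T * S)        ≈⟨ -‿inverseˡ (Q * (M * T * S)) ⟩
      0#                                           ∎
      where
      M = pow (- 1#) j
      T = pow q (triangular j)
      S = pow σ j
      Q = q * pow q j * σ

    F-cassini : ∀ σ j → F (q * σ) (suc j) * F σ (suc j) ≈ F (q * σ) j * F σ (suc (suc j)) + cassiniTerm σ j
    F-cassini σ zero = begin
      1# * 1#                    ≈⟨ +-identityˡ (1# * 1#) ⟨
      0# + 1# * 1#               ≈⟨ +-cong (zeroˡ (F σ 2)) (*-identityʳ (1# * 1#)) ⟨
      0# * F σ 2 + 1# * 1# * 1#  ∎
    F-cassini σ (suc j) = begin
      (x * a + pow q j * (q * σ) * a₀) * b
        ≈⟨ solve 7 (λ x a p q σ a₀ b → (x :* a :+ p :* (q :* σ) :* a₀) :* b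
                                      := x :* a :* b :+ q :* p :* σ :* (a₀ :* b))
                   refl x a (pow q j) q σ a₀ b ⟩
      x * a * b + Q * (a₀ * b)                   ≈⟨ +-identityʳ (x * a * b + Q * (a₀ * b)) ⟨
      x * a * b + Q * (a₀ * b) + 0#              ≈⟨ +-congˡ (cassiniTerm-suc σ j) ⟨
      x * a * b + Q * (a₀ * b) + (ε₁ + Q * ε₀)
        ≈⟨ solve 5 (λ xab Q a₀b ε₀ ε₁ → xab :+ Q :* a₀b :+ (ε₁ :+ Q :* ε₀)
                                       := xab :+ Q :* (a₀b :+ ε₀) :+ ε₁)
                   refl (x * a * b) Q (a₀ * b) ε₀ ε₁ ⟩
      x * a * b + Q * (a₀ * b + ε₀) + ε₁         ≈⟨ +-congʳ (+-congˡ (*-congˡ (F-cassini σ j))) ⟨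
      x * a * b + Q * (a * e) + ε₁
        ≈⟨ +-congʳ (solve 5 (λ x a b Q e → x :* a :* b :+ Q :* (a :* e) := a :* (x :* b :+ Q :* e)) refl x a b Q e) ⟩
      a * (x * b + Q * e) + ε₁                   ∎
      where
      a = F (q * σ) (suc j)
      a₀ = F (q * σ) j
      b = F σ (suc (suc j))
      e = F σ (suc j)
      Q = q * pow q j * σ
      ε₀ = cassiniTerm σ j
      ε₁ = cassiniTerm σ (suc j)

    F-double : ∀ s j (let l = suc j; σ = pow q l * s) →
               F s (suc (l N.+ l)) * F σ l + pow (- 1#) l * pow q (triangular j N.+ l N.* l) * pow s l * F s l
                 ≈ F s (l N.+ l) * F σ (suc l)
    F-double s j = begin
      F s (suc (l N.+ l)) * G + C * Fₗ                    ≈⟨ +-congʳ (*-congʳ (F-add s l l)) ⟩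
      (a * G₁ + σ * Fₗ * G′ l) * G + C * Fₗ
        ≈⟨ solve 7 (λ a G₁ σ Fₗ G′ₗ G C → (a :* G₁ :+ σ :* Fₗ :* G′ₗ) :* G :+ C :* Fₗ
                                        := a :* G₁ :* G :+ σ :* Fₗ :* (G′ₗ :* G) :+ C :* Fₗ)
                   refl a G₁ σ Fₗ (G′ l) G C ⟩
      a * G₁ * G + σ * Fₗ * (G′ l * G) + C * Fₗ           ≈⟨ +-congʳ (+-congˡ (*-congˡ (F-cassini σ j))) ⟩
      a * G₁ * G + σ * Fₗ * (G′ j * G₁ + ε) + C * Fₗ
        ≈⟨ solve 8 (λ a G₁ G σ Fₗ G′ⱼ ε C → a :* G₁ :* G :+ σ :* Fₗ :* (G′ⱼ :* G₁ :+ ε) :+ C :* Fₗ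
                                           := (a :* G :+ σ :* Fₗ :* G′ⱼ) :* G₁ :+ Fₗ :* (σ :* ε :+ C))
                   refl a G₁ G σ Fₗ (G′ j) ε C ⟩
      (a * G + σ * Fₗ * G′ j) * G₁ + Fₗ * (σ * ε + C)     ≈⟨ +-congˡ (trans (*-congˡ σε+C≈0) (zeroʳ Fₗ)) ⟩
      (a * G + σ * Fₗ * G′ j) * G₁ + 0#                   ≈⟨ +-identityʳ ((a * G + σ * Fₗ * G′ j) * G₁) ⟩
      (a * G + σ * Fₗ * G′ j) * G₁                        ≈⟨ *-congʳ (F-add s l j) ⟨
      F s (l N.+ l) * G₁                                  ∎
      where
      l = suc j
      σ = pow q l * s
      C = pow (- 1#) l * pow q (triangular j N.+ l N.* l) * pow s l
      ε = cassiniTerm σ j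
      Fₗ = F s l
      a = F s (suc l)
      G = F σ l
      G₁ = F σ (suc l)
      G′ : ℕ → Carrier
      G′ = F (q * σ)

      σε+C≈0 : σ * ε + C ≈ 0#
      σε+C≈0 = begin
        σ * (M * T * pow σ j) + - 1# * M * pow q (triangular j N.+ l N.* l) * S
          ≈⟨ +-cong (solve 4 (λ σ M T P → σ :* (M :* T :* P) := M :* T :* (σ :* P)) refl σ M T (pow σ j))
                    (*-congʳ (*-congˡ (pow-+ q (triangular j) (l N.* l)))) ⟩
        M * T * pow σ l + - 1# * M * (T * pow q (l N.* l)) * S
          ≈⟨ +-congʳ (*-congˡ (trans (pow-distrib-* (pow q l) s l) (*-congʳ (pow-pow q l l)))) ⟩
        M * T * (pow q (l N.* l) * S) + - 1# * M * (T * pow q (l N.* l)) * S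
          ≈⟨ +-congˡ (solve 5 (λ n M T P S → n :* M :* (T :* P) :* S := n :* (M :* T :* (P :* S)))
                              refl (- 1#) M T (pow q (l N.* l)) S) ⟩
        Y + - 1# * Y                                    ≈⟨ +-congˡ (-1*x≈-x Y) ⟩
        Y + - Y                                         ≈⟨ -‿inverseʳ Y ⟩
        0#                                              ∎
        where
        M = pow (- 1#) j
        T = pow q (triangular j)
        S = pow s l
        Y = M * T * (pow q (l N.* l) * S)

  powℤ : Carrier → Carrier → ℤ → Carrier
  powℤ q q⁻¹ (+ n)    = pow q n
  powℤ q q⁻¹ -[1+ n ] = pow q⁻¹ (suc n)

  module _ {q q⁻¹ : Carrier} (qq⁻¹≈1 : q * q⁻¹ ≈ 1#) where
    powℤ-suc : ∀ m → powℤ q q⁻¹ (Z.suc m) ≈ q * powℤ q q⁻¹ m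
    powℤ-suc (+ n)          = refl
    powℤ-suc -[1+ zero ]    = begin
      1#              ≈⟨ qq⁻¹≈1 ⟨
      q * q⁻¹         ≈⟨ *-congˡ (*-identityʳ q⁻¹) ⟨
      q * (q⁻¹ * 1#)  ∎
    powℤ-suc -[1+ suc n ]   = begin
      pow q⁻¹ (suc n)              ≈⟨ *-identityˡ (pow q⁻¹ (suc n)) ⟨
      1# * pow q⁻¹ (suc n)         ≈⟨ *-congʳ qq⁻¹≈1 ⟨
      q * q⁻¹ * pow q⁻¹ (suc n)    ≈⟨ *-assoc q q⁻¹ (pow q⁻¹ (suc n)) ⟩
      q * pow q⁻¹ (suc (suc n))    ∎

    powℤ-+ : ∀ k m → powℤ q q⁻¹ (+ k Z.+ m) ≈ pow q k * powℤ q q⁻¹ m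
    powℤ-+ zero    m = trans (reflexive (P.cong (powℤ q q⁻¹) (ZP.+-identityˡ m))) (sym (*-identityˡ _))
    powℤ-+ (suc k) m = begin
      powℤ q q⁻¹ (+ suc k Z.+ m)           ≈⟨ reflexive (P.cong (powℤ q q⁻¹) (ZP.suc-+ k m)) ⟩
      powℤ q q⁻¹ (Z.suc (+ k Z.+ m))       ≈⟨ powℤ-suc (+ k Z.+ m) ⟩
      q * powℤ q q⁻¹ (+ k Z.+ m)           ≈⟨ *-congˡ (powℤ-+ k m) ⟩
      q * (pow q k * powℤ q q⁻¹ m)         ≈⟨ *-assoc q (pow q k) (powℤ q q⁻¹ m) ⟨
      q * pow q k * powℤ q q⁻¹ m           ∎

    powℤ-inverse : ∀ m → powℤ q q⁻¹ (Z.- m) * powℤ q q⁻¹ m ≈ 1#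
    powℤ-inverse (+ zero)  = *-identityˡ 1#
    powℤ-inverse (+ suc n) = pow-inverse (trans (*-comm q⁻¹ q) qq⁻¹≈1) (suc n)
    powℤ-inverse -[1+ n ]  = pow-inverse qq⁻¹≈1 (suc n)

    module _ (x : Carrier) {s s⁻¹ : Carrier} (ss⁻¹≈1 : s * s⁻¹ ≈ 1#) where
      weight-cancel : ∀ m {y} → powℤ q q⁻¹ m * s * y ≈ 0# → y ≈ 0#
      weight-cancel m = invertible⇒cancelˡ (inverse-* (powℤ-inverse m) (trans (*-comm s⁻¹ s) ss⁻¹≈1))

      -- This is how fNeg extends f to negative indices.
      solved-for-lowest-term : ∀ b a n → b ≈ x * a + pow q⁻¹ n * s * ((b - x * a) * pow q n * s⁻¹)
      solved-for-lowest-term b a n = sym (begin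
        x * a + pow q⁻¹ n * s * (d * pow q n * s⁻¹)
          ≈⟨ +-congˡ (solve 5 (λ p⁻¹ s p s⁻¹ d → p⁻¹ :* s :* (d :* p :* s⁻¹)
                                                := d :* ((p :* p⁻¹) :* (s :* s⁻¹)))
                              refl (pow q⁻¹ n) s (pow q n) s⁻¹ d) ⟩
        x * a + d * ((pow q n * pow q⁻¹ n) * (s * s⁻¹))
          ≈⟨ +-congˡ (*-congˡ (*-cong (pow-inverse qq⁻¹≈1 n) ss⁻¹≈1)) ⟩
        x * a + d * (1# * 1#)
          ≈⟨ +-congˡ (trans (*-congˡ (*-identityˡ 1#)) (*-identityʳ d)) ⟩
        x * a + (b - x * a)
          ≈⟨ solve 3 (λ xa b n → xa :+ (b :+ n) := b :+ (xa :+ n)) refl (x * a) b (- (x * a)) ⟩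
        b + (x * a - x * a)                               ≈⟨ +-congˡ (-‿inverseʳ (x * a)) ⟩
        b + 0#                                            ≈⟨ +-identityʳ b ⟩
        b                                                 ∎)
        where d = b - x * a

      f-recurrence : Recurrence x (λ m → powℤ q q⁻¹ m * s) (f q x s s⁻¹)
      f-recurrence (+ k)                = refl
      f-recurrence -[1+ zero ]          = solved-for-lowest-term 1# 0# 1
      f-recurrence -[1+ suc zero ]      = solved-for-lowest-term 0# (f q x s s⁻¹ -[1+ 0 ]) 2
      f-recurrence -[1+ suc (suc k) ]   =
        solved-for-lowest-term (f q x s s⁻¹ -[1+ k ]) (f q x s s⁻¹ -[1+ suc k ]) (suc (suc (suc k)))

    f-shifted-recurrence : ∀ x {s s⁻¹} → s * s⁻¹ ≈ 1# → ∀ k →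
      Recurrence x (λ m → powℤ q q⁻¹ m * s) (λ m → f q x (pow q k * s) (pow q⁻¹ k * s⁻¹) (m Z.- + k))
    f-shifted-recurrence x {s} ss⁻¹≈1 k =
      Recurrence-reweight x shifted-weight
        (Recurrence-shift x (+ k) (f-recurrence x (inverse-* (pow-inverse qq⁻¹≈1 k) ss⁻¹≈1)))
      where
      shifted-weight : ∀ m → powℤ q q⁻¹ (m Z.- + k) * (pow q k * s) ≈ powℤ q q⁻¹ m * s
      shifted-weight m = begin
        powℤ q q⁻¹ (m Z.- + k) * (pow q k * s)
          ≈⟨ solve 3 (λ a p s → a :* (p :* s) := p :* a :* s) refl (powℤ q q⁻¹ (m Z.- + k)) (pow q k) s ⟩
        pow q k * powℤ q q⁻¹ (m Z.- + k) * s    ≈⟨ *-congʳ (powℤ-+ k (m Z.- + k)) ⟨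
        powℤ q q⁻¹ (+ k Z.+ (m Z.- + k)) * s    ≡⟨ P.cong (λ n → powℤ q q⁻¹ n * s) (i+[j-i]≡j (+ k) m) ⟩
        powℤ q q⁻¹ m * s                        ∎

    three-term-relation :
      ∀ x {s s⁻¹ d} j (let l = suc j; σ₁ = pow q l * s; σ₂ = pow q (2 N.* l) * s) →
      s * s⁻¹ ≈ 1# → F q x σ₁ l * d ≈ 1# → ∀ m →
      f q x s s⁻¹ m - (F q x s (2 N.* l) * d) * f q x σ₁ (pow q⁻¹ l * s⁻¹) (m Z.- + l)
        + pow (- 1#) l * pow q (triangular j N.+ l N.* l) * pow s l * (F q x s l * d)
          * f q x σ₂ (pow q⁻¹ (2 N.* l) * s⁻¹) (m Z.- + (2 N.* l))
        ≈ 0#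
    three-term-relation x {s} {s⁻¹} {d} j ss⁻¹≈1 Gd≈1 =
      Recurrence-vanishing x combination (weight-cancel x ss⁻¹≈1) (+ (2 N.* l))
        (a+c≈b⇒a-b+c≈0 at-2l) (a+c≈b⇒a-b+c≈0 at-2l+1)
      where
      l = suc j
      σ₁ = pow q l * s
      σ₂ = pow q (2 N.* l) * s
      σ₁⁻¹ = pow q⁻¹ l * s⁻¹
      σ₂⁻¹ = pow q⁻¹ (2 N.* l) * s⁻¹
      C = pow (- 1#) l * pow q (triangular j N.+ l N.* l) * pow s l
      W = F q x s (2 N.* l)
      X = F q x s (suc (2 N.* l))
      Fₗ = F q x s l
      G = F q x σ₁ l
      G₁ = F q x σ₁ (suc l)
      β = C * (Fₗ * d)
      g₁ g₂ : ℤ → Carrier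
      g₁ m = f q x σ₁ σ₁⁻¹ (m Z.- + l)
      g₂ m = f q x σ₂ σ₂⁻¹ (m Z.- + (2 N.* l))

      combination : Recurrence x (λ m → powℤ q q⁻¹ m * s) (λ m → f q x s s⁻¹ m - W * d * g₁ m + β * g₂ m)
      combination =
        Recurrence-+ x (Recurrence-+ x (f-recurrence x ss⁻¹≈1)
                                       (Recurrence-neg x (Recurrence-*ˡ x (W * d) (f-shifted-recurrence x ss⁻¹≈1 l))))
                       (Recurrence-*ˡ x β (f-shifted-recurrence x ss⁻¹≈1 (2 N.* l)))

      double : 2 N.* l ≡ l N.+ l
      double = P.cong (l N.+_) (NP.+-identityʳ l)

      F-double′ : X * G + C * Fₗ ≈ W * G₁
      F-double′ = begin
        X * G + C * Fₗ                      ≡⟨ P.cong (λ n → F q x s (suc n) * G + C * Fₗ) double ⟩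
        F q x s (suc (l N.+ l)) * G + C * Fₗ ≈⟨ F-double q x s j ⟩
        F q x s (l N.+ l) * G₁              ≡⟨ P.cong (λ n → F q x s n * G₁) double ⟨
        W * G₁                              ∎

      at-2l : W + β * g₂ (+ (2 N.* l)) ≈ W * d * g₁ (+ (2 N.* l))
      at-2l = begin
        W + β * g₂ (+ (2 N.* l))
          ≡⟨ P.cong (λ n → W + β * f q x σ₂ σ₂⁻¹ n) (ZP.+-inverseʳ (+ (2 N.* l))) ⟩
        W + β * 0#                ≈⟨ trans (+-congˡ (zeroʳ β)) (+-identityʳ W) ⟩
        W                         ≈⟨ trans (*-congˡ Gd≈1) (*-identityʳ W) ⟨
        W * (G * d)               ≈⟨ solve 3 (λ W G d → W :* (G :* d) := W :* d :* G) refl W G d ⟩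
        W * d * G                 ≡⟨ P.cong (λ n → W * d * f q x σ₁ σ₁⁻¹ n) (+[2*l]-+l≡+l l) ⟨
        W * d * g₁ (+ (2 N.* l))  ∎

      at-2l+1 : X + β * g₂ (Z.suc (+ (2 N.* l))) ≈ W * d * g₁ (Z.suc (+ (2 N.* l)))
      at-2l+1 = begin
        X + β * g₂ (Z.suc (+ (2 N.* l)))
          ≡⟨ P.cong (λ n → X + β * f q x σ₂ σ₂⁻¹ n)
                    (P.trans (suc[i]-j≡suc[i-j] (+ (2 N.* l)) (+ (2 N.* l)))
                             (P.cong Z.suc (ZP.+-inverseʳ (+ (2 N.* l))))) ⟩
        X + β * 1#                ≈⟨ +-congˡ (*-identityʳ β) ⟩
        X + C * (Fₗ * d)          ≈⟨ +-congʳ (trans (*-congˡ Gd≈1) (*-identityʳ X)) ⟨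
        X * (G * d) + C * (Fₗ * d)
          ≈⟨ solve 5 (λ X G d C Fₗ → X :* (G :* d) :+ C :* (Fₗ :* d) := (X :* G :+ C :* Fₗ) :* d)
                     refl X G d C Fₗ ⟩
        (X * G + C * Fₗ) * d      ≈⟨ *-congʳ F-double′ ⟩
        W * G₁ * d                ≈⟨ solve 3 (λ W G₁ d → W :* G₁ :* d := W :* d :* G₁) refl W G₁ d ⟩
        W * d * G₁
          ≡⟨ P.cong (λ n → W * d * f q x σ₁ σ₁⁻¹ n)
                    (P.trans (suc[i]-j≡suc[i-j] (+ (2 N.* l)) (+ l)) (P.cong Z.suc (+[2*l]-+l≡+l l))) ⟨
        W * d * g₁ (Z.suc (+ (2 N.* l))) ∎

mainTheorem4 : ∀ {c r} (R : CommutativeRing c r) →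
    let open CommutativeRing R
        open QFib R
    in (l : ℕ) → 1 ≤ l → (n : Z.ℤ) → (q qi x s si d : Carrier) →
       q * qi ≈ 1# → s * si ≈ 1# →
       f q x (pow q l * s) (pow qi l * si) (Z.+ l) * d ≈ 1# →
       (f q x s si (Z.+ l Z.* n)
         - (f q x s si (Z.+ (2 N.* l)) * d)
             * f q x (pow q l * s) (pow qi l * si) (Z.+ l Z.* (n Z.- Z.+ 1))
         + pow (- 1#) l * pow q ((l N.* (3 N.* l ∸ 1)) / 2) * pow s l
             * (f q x s si (Z.+ l) * d)
             * f q x (pow q (2 N.* l) * s) (pow qi (2 N.* l) * si) (Z.+ l Z.* (n Z.- Z.+ 2)))
       ≈ 0#
mainTheorem4 R (suc j) _ n q qi x s si d qqi≈1 ssi≈1 Gd≈1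
  rewrite pentagonal-number j | i*[j-1]≡i*j-i (+ suc j) n | +l*[n-2]≡+l*n-+[2*l] (suc j) n
  = three-term-relation qqi≈1 x j ssi≈1 Gd≈1 (+ suc j Z.* n)
  where open QFibProperties R
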